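{- Let $\boldsymbol{k}$ be a field and work with $\mathbb N\times\mathbb N$ matrices over $\boldsymbol{k}$. For every $m\in\mathbb N$, $$\big(\oplus(\mathcal{I})-\ominus(\mathcal{I})\big)^{m}=\sum_{r=0}^m\binom{m}{r}(-1)^r\oplus^{m-2r}(\mathcal{I})\;+\;(-1)^m\sum_{l=0}^{\lfloor m/2\rfloor-1}\binom{m}{l}(-1)^l\mathcal{J}^{(a)}_{m-1-2l}.$$
   Context: $\mathcal{I}$ is the $\mathbb N\times\mathbb N$ identity matrix (indices start at 1). For $\mathcal{M}=(m_{i,j})_{i,j\ge1}$, $\oplus(\mathcal{M})$ has $(i,j)$ entry $m_{i-1,j}$ if $i>1$ and $0$ if $i=1$, and $\ominus(\mathcal{M})$ has $(i,j)$ entry $m_{i+1,j}$. For $s\ge0$, $\oplus^s$ and $\ominus^s$ denote $s$-fold iterates ($\oplus^0=\ominus^0=$ identity map), and $\oplus^{ -s}:=\ominus^{s}$. Thus $\oplus(\mathcal{I})$ has ones on the subdiagonal and $\ominus(\mathcal{I})$ has ones on the superdiagonal. $\mathcal{J}^{(a)}_l$ is the matrix whose $(i,j)$ entry is $(-1)^{i-1}$ if $i+j=l+1$ and $0$ otherwise. Integer coefficients are interpreted in $\boldsymbol{k}$. -}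

module Defs where

open import Level using (Level; _⊔_) renaming (suc to lsuc)
open import Algebra.Bundles using (CommutativeRing)
open import Data.Nat using (ℕ; zero; suc; _≤_; _<_; _≡ᵇ_; s≤s; z≤n)
import Data.Nat as ℕ
open import Data.Nat.Properties using (≤-trans; m≤n+m)
open import Data.Integer using (ℤ; +_; -[1+_])
open import Data.Bool using (Bool; true; false; if_then_else_)
open import Data.Product using (∃)
open import Relation.Nullary using (¬_)

record Field (c ℓ : Level) : Set (lsuc (c ⊔ ℓ)) where
  field
    commutativeRing : CommutativeRing c ℓ
  open CommutativeRing commutativeRing public
  field
    1≉0     : ¬ (1# ≈ 0#)
    inverse : ∀ x → ¬ (x ≈ 0#) → ∃ λ y → x * y ≈ 1#

module FieldMatrices {c ℓ} (F : Field c ℓ) where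
  open Field F

  -- ℕ × ℕ matrices over k.  INDEXING CONVENTION: indices here start at 0;
  -- entry (i , j) here is the paper's entry (i+1 , j+1).
  Matrix : Set c
  Matrix = ℕ → ℕ → Carrier

  _≋_ : Matrix → Matrix → Set ℓ
  A ≋ B = ∀ i j → A i j ≈ B i j
  infix 4 _≋_

  _⊞_ : Matrix → Matrix → Matrix
  (A ⊞ B) i j = A i j + B i j
  infixl 6 _⊞_

  _⊟_ : Matrix → Matrix → Matrix
  (A ⊟ B) i j = A i j - B i j
  infixl 6 _⊟_

  _⊛_ : Carrier → Matrix → Matrix
  (a ⊛ A) i j = a * A i j
  infixr 7 _⊛_

  zeroM : Matrix
  zeroM i j = 0#

  ΣM : ℕ → (ℕ → Matrix) → Matrix
  ΣM zero    f = zeroM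
  ΣM (suc n) f = ΣM n f ⊞ f n

  Σk : ℕ → (ℕ → Carrier) → Carrier
  Σk zero    f = 0#
  Σk (suc n) f = Σk n f + f n

  fromℕ : ℕ → Carrier
  fromℕ zero    = 0#
  fromℕ (suc n) = 1# + fromℕ n

  sign : ℕ → Carrier
  sign zero    = 1#
  sign (suc n) = - sign n

  𝓘 : Matrix
  𝓘 i j = if i ≡ᵇ j then 1# else 0#

  ⊕ : Matrix → Matrix
  ⊕ M zero    j = 0#
  ⊕ M (suc i) j = M i j

  ⊖ : Matrix → Matrix
  ⊖ M i j = M (suc i) j

  iter : ℕ → (Matrix → Matrix) → Matrix → Matrix
  iter zero    g M = M
  iter (suc n) g M = g (iter n g M)

  ⊕^ : ℤ → Matrix → Matrix
  ⊕^ (+ n)     M = iter n ⊕ M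
  ⊕^ -[1+ n ]  M = iter (suc n) ⊖ M

  -- 𝓙^(a)_l : paper entry (i,j) is (-1)^(i-1) if i + j = l + 1, else 0.
  -- With 0-based i j: paper indices are i+1, j+1.
  𝓙 : ℕ → Matrix
  𝓙 l i j = if (suc i ℕ.+ suc j) ≡ᵇ suc l then sign i else 0#

  -- Row-finite matrices: row i vanishes from column (bound i) on.
  -- For these, the matrix product (A·B)_{ij} = Σ_k a_{ik} b_{kj} is a finite sum.
  record RowFinite : Set (c ⊔ ℓ) where
    field
      entries : Matrix
      bound   : ℕ → ℕ
      finite  : ∀ i k → bound i ≤ k → entries i k ≈ 0#
  open RowFinite public

  _·_ : RowFinite → Matrix → Matrix
  (A · B) i j = Σk (bound A i) (λ k → entries A i k * B k j)

  pow : RowFinite → ℕ → Matrix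
  pow A zero    = 𝓘
  pow A (suc m) = A · pow A m

  private
    𝓘-zero : ∀ a b → a < b → 𝓘 a b ≈ 0#
    𝓘-zero zero    (suc b) _       = refl
    𝓘-zero (suc a) (suc b) (s≤s p) = 𝓘-zero a b p

    sub0 : ∀ {x y} → x ≈ 0# → y ≈ 0# → x - y ≈ 0#
    sub0 x0 y0 = trans (+-cong x0 (-‿cong y0)) (-‿inverseʳ 0#)

    fin : ∀ i k → suc (suc i) ≤ k → (⊕ 𝓘 ⊟ ⊖ 𝓘) i k ≈ 0#
    fin zero    k p = sub0 refl (𝓘-zero 1 k p)
    fin (suc i) k p = sub0 (𝓘-zero i k (≤-trans (m≤n+m (suc i) 2) p)) (𝓘-zero (suc (suc i)) k p)

  D : RowFinite
  D = record { entries = ⊕ 𝓘 ⊟ ⊖ 𝓘 ; bound = λ i → suc (suc i) ; finite = fin }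

-- D acts on the row index as multiplication by x − x⁻¹ acts on Laurent polynomials, except
-- that row 0 has nothing above it.  Let laurent m d be the coefficient of x^d in (x − x⁻¹)^m.
-- Since laurent m (− d) = (−1)^d · laurent m d, the combination
--   laurent m (i − j) + (−1)^j · laurent m (i + j + 2)
-- (the free kernel plus that of the source j mirrored to −2 − j) vanishes on the virtual
-- row i = −1, so it obeys both the recursion and the boundary condition of the powers of D
-- and is the (i, j) entry of D^m (indices from 0).  Expanding laurent binomially, the first
-- term gives the ⊕-sum; in the second only the terms with m − 2l = i + j + 2 ≥ 2, i.e.
-- l < m / 2, survive, and those are the entries of the 𝓙 matrices.
module Submission where

open import Defs
open import Data.Nat using (ℕ; suc; _∸_; _/_)
import Data.Nat as ℕ
open import Data.Nat.Combinatorics using (_C_)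
open import Data.Integer using (+_)
import Data.Integer as ℤ

open import Data.Bool using (true; false; if_then_else_)
open import Data.Nat using (zero; _≤_; _<_; _≤′_; ≤′-refl; ≤′-step; s≤s; z≤n)
import Data.Nat.Properties as ℕₚ
open import Data.Nat.Combinatorics using (k>n⇒nCk≡0; nCk+nC[k+1]≡[n+1]C[k+1])
open import Data.Nat.DivMod using (m/n≤m; m/n*n≤m; m*n/n≡m; /-monoˡ-≤)
open import Data.Integer using (ℤ; 0ℤ; -[1+_]; ∣_∣)
import Data.Integer.Properties as ℤₚ
open import Data.Integer.Tactic.RingSolver using (solve-∀)
open import Function using (_∘_)
open import Relation.Nullary using (Dec; does; yes; no; ¬_)
open import Relation.Nullary.Decidable using (dec-true; dec-false)
open import Relation.Binary.PropositionalEquality as ≡ using (_≡_; _≢_)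
import Algebra.Properties.Ring as RingProperties
import Algebra.Properties.CommutativeSemigroup as CommutativeSemigroupProperties

≤/2⇒2*≤ : ∀ {k m} → k ≤ m / 2 → 2 ℕ.* k ≤ m
≤/2⇒2*≤ {k} {m} k≤m/2 =
  ℕₚ.≤-trans (ℕₚ.*-monoʳ-≤ 2 k≤m/2)
             (ℕₚ.≤-trans (ℕₚ.≤-reflexive (ℕₚ.*-comm 2 (m / 2))) (m/n*n≤m m 2))

2*≤⇒≤/2 : ∀ {k m} → 2 ℕ.* k ≤ m → k ≤ m / 2
2*≤⇒≤/2 {k} {m} 2k≤m =
  ℕₚ.≤-trans (ℕₚ.≤-reflexive (≡.sym (m*n/n≡m k 2)))
             (/-monoˡ-≤ 2 (ℕₚ.≤-trans (ℕₚ.≤-reflexive (ℕₚ.*-comm k 2)) 2k≤m))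

module _ {c ℓ} (F : Field c ℓ) where
  open Field F
  open FieldMatrices F
  open RingProperties ring
  open CommutativeSemigroupProperties +-commutativeSemigroup using (interchange)
  open CommutativeSemigroupProperties *-commutativeSemigroup using (x∙yz≈xz∙y)
  open import Relation.Binary.Reasoning.Setoid setoid

  [a-b]+[c-d]≈[a+c]-[b+d] : ∀ a b c d → (a - b) + (c - d) ≈ (a + c) - (b + d)
  [a-b]+[c-d]≈[a+c]-[b+d] a b c d = trans (interchange a (- b) c (- d)) (+-congˡ (-‿+-comm b d))

  𝟙 : ∀ {p} {P : Set p} → Dec P → Carrier
  𝟙 P? = if does P? then 1# else 0#

  𝟙-yes : ∀ {p} {P : Set p} (P? : Dec P) → P → 𝟙 P? ≈ 1#
  𝟙-yes P? p rewrite dec-true P? p = refl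

  𝟙-no : ∀ {p} {P : Set p} (P? : Dec P) → ¬ P → 𝟙 P? ≈ 0#
  𝟙-no P? ¬p rewrite dec-false P? ¬p = refl

  𝟙-cong : ∀ {p q} {P : Set p} {Q : Set q} (P? : Dec P) (Q? : Dec Q) →
           (P → Q) → (Q → P) → 𝟙 P? ≈ 𝟙 Q?
  𝟙-cong (yes p) Q? P⇒Q Q⇒P = sym (𝟙-yes Q? (P⇒Q p))
  𝟙-cong (no ¬p) Q? P⇒Q Q⇒P = sym (𝟙-no Q? (¬p ∘ Q⇒P))

  *𝟙-congʳ : ∀ {p} {P : Set p} (P? : Dec P) {x y} → (P → x ≈ y) → x * 𝟙 P? ≈ y * 𝟙 P?
  *𝟙-congʳ (yes p) x≈y = *-congʳ (x≈y p)
  *𝟙-congʳ (no _)  x≈y = trans (zeroʳ _) (sym (zeroʳ _))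

  if-then-else-0 : ∀ b x → (if b then x else 0#) ≈ x * (if b then 1# else 0#)
  if-then-else-0 true  x = sym (*-identityʳ x)
  if-then-else-0 false x = sym (zeroʳ x)

  -- 𝓘 i j and δ (+ i) (+ j) are definitionally equal, as are δ (+ suc a) (+ suc b) and
  -- δ (+ a) (+ b); several base cases below hold by refl for this reason.
  δ : ℤ → ℤ → Carrier
  δ a b = 𝟙 (a ℤ.≟ b)

  δ-suc : ∀ a b → δ (ℤ.suc a) b ≈ δ a (ℤ.pred b)
  δ-suc a b = 𝟙-cong (ℤ.suc a ℤ.≟ b) (a ℤ.≟ ℤ.pred b)
    (λ e → ≡.trans (≡.sym (ℤₚ.pred-suc a)) (≡.cong ℤ.pred e))
    (λ e → ≡.trans (≡.cong ℤ.suc e) (ℤₚ.suc-pred b))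

  δ-pred : ∀ a b → δ (ℤ.pred a) b ≈ δ a (ℤ.suc b)
  δ-pred a b = 𝟙-cong (ℤ.pred a ℤ.≟ b) (a ℤ.≟ ℤ.suc b)
    (λ e → ≡.trans (≡.sym (ℤₚ.suc-pred a)) (≡.cong ℤ.suc e))
    (λ e → ≡.trans (≡.cong ℤ.pred e) (ℤₚ.pred-suc b))

  δ-translate : ∀ a e b → δ a (e ℤ.+ b) ≈ δ e (a ℤ.- b)
  δ-translate a e b = 𝟙-cong (a ℤ.≟ e ℤ.+ b) (e ℤ.≟ a ℤ.- b)
    (λ a≡e+b → ≡.trans (cancel e b) (≡.cong (ℤ._- b) (≡.sym a≡e+b)))
    (λ e≡a-b → ≡.trans (uncancel a b) (≡.cong (ℤ._+ b) (≡.sym e≡a-b)))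
    where
    cancel : ∀ x y → x ≡ (x ℤ.+ y) ℤ.- y
    cancel = solve-∀
    uncancel : ∀ x y → x ≡ (x ℤ.- y) ℤ.+ y
    uncancel = solve-∀

  δ-minus : ∀ m a b → δ (+ m ℤ.- + a) (+ b) ≈ 𝟙 (m ℕ.≟ a ℕ.+ b)
  δ-minus m a b = 𝟙-cong (+ m ℤ.- + a ℤ.≟ + b) (m ℕ.≟ a ℕ.+ b)
    (λ e → ℤₚ.+-injective (≡.trans (split (+ m) (+ a)) (≡.cong (λ x → + a ℤ.+ x) e)))
    (λ { ≡.refl → cancel (+ a) (+ b) })
    where
    split : ∀ x y → x ≡ y ℤ.+ (x ℤ.- y)
    split = solve-∀
    cancel : ∀ x y → (x ℤ.+ y) ℤ.- x ≡ y
    cancel = solve-∀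

  Σk-cong : ∀ n {f g : ℕ → Carrier} → (∀ k → k < n → f k ≈ g k) → Σk n f ≈ Σk n g
  Σk-cong zero    f≈g = refl
  Σk-cong (suc n) f≈g = +-cong (Σk-cong n (λ k → f≈g k ∘ ℕₚ.m<n⇒m<1+n)) (f≈g n ℕₚ.≤-refl)

  Σk-- : ∀ n (f g : ℕ → Carrier) → Σk n (λ k → f k - g k) ≈ Σk n f - Σk n g
  Σk-- zero    f g = sym (-‿inverseʳ 0#)
  Σk-- (suc n) f g = trans (+-congʳ (Σk-- n f g)) ([a-b]+[c-d]≈[a+c]-[b+d] _ _ _ _)

  Σk-*ˡ : ∀ n a (f : ℕ → Carrier) → Σk n (λ k → a * f k) ≈ a * Σk n f
  Σk-*ˡ zero    a f = sym (zeroʳ a)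
  Σk-*ˡ (suc n) a f = trans (+-congʳ (Σk-*ˡ n a f)) (sym (distribˡ a _ _))

  Σk-suc : ∀ n (f : ℕ → Carrier) → Σk (suc n) f ≈ f 0 + Σk n (f ∘ suc)
  Σk-suc zero    f = trans (+-identityˡ (f 0)) (sym (+-identityʳ (f 0)))
  Σk-suc (suc n) f = trans (+-congʳ (Σk-suc n f)) (+-assoc _ _ _)

  Σk-tail : ∀ {n N} (f : ℕ → Carrier) → n ≤ N → (∀ k → n ≤ k → k < N → f k ≈ 0#) →
            Σk N f ≈ Σk n f
  Σk-tail f n≤N = go (ℕₚ.≤⇒≤′ n≤N)
    where
    go : ∀ {n N} → n ≤′ N → (∀ k → n ≤ k → k < N → f k ≈ 0#) → Σk N f ≈ Σk n f
    go ≤′-refl           f≈0 = refl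
    go (≤′-step {N} n≤N) f≈0 = begin
      Σk N f + f N ≈⟨ +-cong (go n≤N (λ k n≤k k<N → f≈0 k n≤k (ℕₚ.m<n⇒m<1+n k<N)))
                             (f≈0 N (ℕₚ.≤′⇒≤ n≤N) ℕₚ.≤-refl) ⟩
      _ + 0#       ≈⟨ +-identityʳ _ ⟩
      _            ∎

  ΣM-entry : ∀ n (f : ℕ → Matrix) i j → ΣM n f i j ≈ Σk n (λ r → f r i j)
  ΣM-entry zero    f i j = refl
  ΣM-entry (suc n) f i j = +-congʳ (ΣM-entry n f i j)

  Σk-𝓘 : ∀ {n} a (f : ℕ → Carrier) → a < n → Σk n (λ k → 𝓘 a k * f k) ≈ f a
  Σk-𝓘 {suc n} a f a<1+n with a ℕ.≟ n
  ... | yes ≡.refl = begin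
    Σk a (λ k → 𝓘 a k * f k) + 𝓘 a a * f a
      ≈⟨ +-cong (Σk-tail _ z≤n (λ k _ k<a → off-diagonal k (ℕₚ.>⇒≢ k<a)))
                (*-congʳ (𝟙-yes (a ℕ.≟ a) ≡.refl)) ⟩
    0# + 1# * f a ≈⟨ trans (+-identityˡ _) (*-identityˡ _) ⟩
    f a           ∎
    where
    off-diagonal : ∀ k → a ≢ k → 𝓘 a k * f k ≈ 0#
    off-diagonal k a≢k = trans (*-congʳ (𝟙-no (a ℕ.≟ k) a≢k)) (zeroˡ (f k))
  ... | no a≢n = begin
    Σk n (λ k → 𝓘 a k * f k) + 𝓘 a n * f n
      ≈⟨ +-cong (Σk-𝓘 a f (ℕₚ.≤∧≢⇒< (ℕₚ.≤-pred a<1+n) a≢n))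
                (trans (*-congʳ (𝟙-no (a ℕ.≟ n) a≢n)) (zeroˡ (f n))) ⟩
    f a + 0# ≈⟨ +-identityʳ _ ⟩
    f a      ∎

  Σk-⊕𝓘 : ∀ {n} (X : Matrix) i j → i < n → Σk n (λ k → ⊕ 𝓘 i k * X k j) ≈ ⊕ X i j
  Σk-⊕𝓘 {n} X zero    j _   = Σk-tail {N = n} _ z≤n (λ k _ _ → zeroˡ (X k j))
  Σk-⊕𝓘     X (suc i) j i<n = Σk-𝓘 i (λ k → X k j) (ℕₚ.<-trans (ℕₚ.n<1+n i) i<n)

  sign-+ : ∀ a b → sign (a ℕ.+ b) ≈ sign a * sign b
  sign-+ zero    b = sym (*-identityˡ _)
  sign-+ (suc a) b = trans (-‿cong (sign-+ a b)) (-‿distribˡ-* _ _)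

  sign-*-self : ∀ a → sign a * sign a ≈ 1#
  sign-*-self zero    = *-identityˡ 1#
  sign-*-self (suc a) = begin
    - sign a * - sign a   ≈⟨ sym (-‿distribˡ-* _ _) ⟩
    - (sign a * - sign a) ≈⟨ -‿cong (sym (-‿distribʳ-* _ _)) ⟩
    - - (sign a * sign a) ≈⟨ -‿involutive _ ⟩
    sign a * sign a       ≈⟨ sign-*-self a ⟩
    1#                    ∎

  sign-double : ∀ l → sign (2 ℕ.* l) ≈ 1#
  sign-double l = begin
    sign (l ℕ.+ (l ℕ.+ 0))  ≈⟨ sign-+ l (l ℕ.+ 0) ⟩
    sign l * sign (l ℕ.+ 0) ≡⟨ ≡.cong (λ n → sign l * sign n) (ℕₚ.+-identityʳ l) ⟩
    sign l * sign l         ≈⟨ sign-*-self l ⟩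
    1#                      ∎

  sign-image : ∀ l i j → sign (2 ℕ.* l ℕ.+ (suc i ℕ.+ suc j)) * sign i ≈ sign j
  sign-image l i j = begin
    sign (2 ℕ.* l ℕ.+ (suc i ℕ.+ suc j)) * sign i
      ≈⟨ *-congʳ (trans (sign-+ (2 ℕ.* l) _) (trans (*-congʳ (sign-double l)) (*-identityˡ _))) ⟩
    - sign (i ℕ.+ suc j) * sign i
      ≈⟨ *-congʳ (-‿cong (sign-+ i (suc j))) ⟩
    - (sign i * - sign j) * sign i
      ≈⟨ *-congʳ (trans (-‿distribʳ-* _ _) (*-congˡ (-‿involutive _))) ⟩
    sign i * sign j * sign i
      ≈⟨ trans (*-assoc _ _ _) (trans (*-congˡ (*-comm _ _)) (sym (*-assoc _ _ _))) ⟩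
    sign i * sign i * sign j
      ≈⟨ trans (*-congʳ (sign-*-self i)) (*-identityˡ _) ⟩
    sign j ∎

  sign-∣suc∣ : ∀ d → sign ∣ ℤ.suc d ∣ ≈ - sign ∣ d ∣
  sign-∣suc∣ (+ n)        = refl
  sign-∣suc∣ -[1+ zero ]  = sym (-‿involutive 1#)
  sign-∣suc∣ -[1+ suc n ] = sym (-‿involutive _)

  sign-∣pred∣ : ∀ d → sign ∣ ℤ.pred d ∣ ≈ - sign ∣ d ∣
  sign-∣pred∣ (+ zero)  = refl
  sign-∣pred∣ (+ suc n) = sym (-‿involutive _)
  sign-∣pred∣ -[1+ n ]  = refl

  fromℕ-+ : ∀ a b → fromℕ (a ℕ.+ b) ≈ fromℕ a + fromℕ b
  fromℕ-+ zero    b = sym (+-identityˡ _)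
  fromℕ-+ (suc a) b = trans (+-congˡ (fromℕ-+ a b)) (sym (+-assoc _ _ _))

  -- The Laurent polynomial (x − x⁻¹)^m

  laurent : ℕ → ℤ → Carrier
  laurent zero    d = δ 0ℤ d
  laurent (suc m) d = laurent m (ℤ.pred d) - laurent m (ℤ.suc d)

  laurent-neg : ∀ m d → laurent m (ℤ.- d) ≈ sign ∣ d ∣ * laurent m d
  laurent-neg zero    (+ zero)  = sym (*-identityˡ 1#)
  laurent-neg zero    (+ suc n) = sym (zeroʳ _)
  laurent-neg zero    -[1+ n ]  = sym (zeroʳ _)
  laurent-neg (suc m) d = begin
    laurent m (ℤ.pred (ℤ.- d)) - laurent m (ℤ.suc (ℤ.- d))
      ≡⟨ ≡.cong₂ (λ x y → laurent m x - laurent m y)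
                 (≡.sym (ℤₚ.neg-distrib-+ (+ 1) d)) (≡.sym (ℤₚ.neg-distrib-+ -[1+ 0 ] d)) ⟩
    laurent m (ℤ.- ℤ.suc d) - laurent m (ℤ.- ℤ.pred d)
      ≈⟨ +-cong (laurent-neg m (ℤ.suc d)) (-‿cong (laurent-neg m (ℤ.pred d))) ⟩
    sign ∣ ℤ.suc d ∣ * laurent m (ℤ.suc d) - sign ∣ ℤ.pred d ∣ * laurent m (ℤ.pred d)
      ≈⟨ +-cong (*-congʳ (sign-∣suc∣ d)) (-‿cong (*-congʳ (sign-∣pred∣ d))) ⟩
    - s * laurent m (ℤ.suc d) - - s * laurent m (ℤ.pred d)
      ≈⟨ sym (x[y-z]≈xy-xz (- s) _ _) ⟩
    - s * (laurent m (ℤ.suc d) - laurent m (ℤ.pred d))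
      ≈⟨ trans (sym (-‿distribˡ-* s _)) (-‿distribʳ-* s _) ⟩
    s * - (laurent m (ℤ.suc d) - laurent m (ℤ.pred d))
      ≈⟨ *-congˡ (⁻¹-anti-homo‿- _ _) ⟩
    s * laurent (suc m) d ∎
    where
    s : Carrier
    s = sign ∣ d ∣

  coeff : ℕ → ℕ → Carrier
  coeff m r = fromℕ (m C r) * sign r

  exponent : ℕ → ℕ → ℤ
  exponent m r = + m ℤ.- + (2 ℕ.* r)

  binomialTerm : ℕ → ℤ → ℕ → Carrier
  binomialTerm m d r = coeff m r * δ (exponent m r) d

  coeff-pascal : ∀ m r → coeff (suc m) (suc r) ≈ coeff m (suc r) - coeff m r
  coeff-pascal m r = begin
    fromℕ (suc m C suc r) * - sign r
      ≡⟨ ≡.cong (λ n → fromℕ n * - sign r) (≡.sym (nCk+nC[k+1]≡[n+1]C[k+1] m r)) ⟩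
    fromℕ (m C r ℕ.+ m C suc r) * - sign r
      ≈⟨ *-congʳ (trans (fromℕ-+ (m C r) (m C suc r)) (+-comm _ _)) ⟩
    (fromℕ (m C suc r) + fromℕ (m C r)) * - sign r
      ≈⟨ distribʳ _ _ _ ⟩
    fromℕ (m C suc r) * - sign r + fromℕ (m C r) * - sign r
      ≈⟨ +-congˡ (sym (-‿distribʳ-* _ _)) ⟩
    coeff m (suc r) - coeff m r ∎

  exponent-suc : ∀ m r → exponent (suc m) r ≡ ℤ.suc (exponent m r)
  exponent-suc m r = ℤₚ.suc-+ m (ℤ.- + (2 ℕ.* r))

  exponent-suc-suc : ∀ m r → exponent (suc m) (suc r) ≡ ℤ.pred (exponent m r)
  exponent-suc-suc m r =
    ≡.trans (≡.cong (λ n → + suc m ℤ.- + n) (ℕₚ.*-suc 2 r)) (shift (+ m) (+ (2 ℕ.* r)))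
    where
    shift : ∀ x y → (+ 1 ℤ.+ x) ℤ.- (+ 2 ℤ.+ y) ≡ ℤ.- + 1 ℤ.+ (x ℤ.- y)
    shift = solve-∀

  binomialTerm-pascal : ∀ m d r →
    binomialTerm (suc m) d (suc r) ≈ binomialTerm m (ℤ.pred d) (suc r) - binomialTerm m (ℤ.suc d) r
  binomialTerm-pascal m d r = begin
    coeff (suc m) (suc r) * δ E d
      ≈⟨ trans (*-congʳ (coeff-pascal m r)) ([y-z]x≈yx-zx _ _ _) ⟩
    coeff m (suc r) * δ E d - coeff m r * δ E d
      ≈⟨ +-cong (*-congˡ (trans (reflexive E≡suc) (δ-suc (exponent m (suc r)) d)))
                (-‿cong (*-congˡ (trans (reflexive E≡pred) (δ-pred (exponent m r) d)))) ⟩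
    binomialTerm m (ℤ.pred d) (suc r) - binomialTerm m (ℤ.suc d) r ∎
    where
    E : ℤ
    E = exponent (suc m) (suc r)
    E≡suc : δ E d ≡ δ (ℤ.suc (exponent m (suc r))) d
    E≡suc = ≡.cong (λ e → δ e d) (exponent-suc m (suc r))
    E≡pred : δ E d ≡ δ (ℤ.pred (exponent m r)) d
    E≡pred = ≡.cong (λ e → δ e d) (exponent-suc-suc m r)

  binomialTerm-overflow : ∀ m d r → m < r → binomialTerm m d r ≈ 0#
  binomialTerm-overflow m d r m<r = begin
    fromℕ (m C r) * sign r * δ (exponent m r) d
      ≡⟨ ≡.cong (λ n → fromℕ n * sign r * δ (exponent m r) d) (k>n⇒nCk≡0 m<r) ⟩
    0# * sign r * δ (exponent m r) d
      ≈⟨ trans (*-congʳ (zeroˡ _)) (zeroˡ _) ⟩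
    0# ∎

  binomialSum-pascal : ∀ m d →
    Σk (suc (suc m)) (binomialTerm (suc m) d) ≈
    Σk (suc m) (binomialTerm m (ℤ.pred d)) - Σk (suc m) (binomialTerm m (ℤ.suc d))
  binomialSum-pascal m d = begin
    Σk (suc (suc m)) (binomialTerm (suc m) d)
      ≈⟨ Σk-suc (suc m) _ ⟩
    binomialTerm (suc m) d 0 + Σk (suc m) (binomialTerm (suc m) d ∘ suc)
      ≈⟨ +-cong head (trans (Σk-cong (suc m) (λ r _ → binomialTerm-pascal m d r)) (Σk-- (suc m) _ _)) ⟩
    t⁻ 0 + (Σk (suc m) (t⁻ ∘ suc) - Σk (suc m) t⁺)
      ≈⟨ sym (+-assoc _ _ _) ⟩
    (t⁻ 0 + Σk (suc m) (t⁻ ∘ suc)) - Σk (suc m) t⁺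
      ≈⟨ +-congʳ (sym (Σk-suc (suc m) t⁻)) ⟩
    Σk (suc (suc m)) t⁻ - Σk (suc m) t⁺
      ≈⟨ +-congʳ (Σk-tail t⁻ (ℕₚ.n≤1+n (suc m)) (λ k m<k _ → binomialTerm-overflow m _ k m<k)) ⟩
    Σk (suc m) t⁻ - Σk (suc m) t⁺ ∎
    where
    t⁻ t⁺ : ℕ → Carrier
    t⁻ = binomialTerm m (ℤ.pred d)
    t⁺ = binomialTerm m (ℤ.suc d)
    head : binomialTerm (suc m) d 0 ≈ t⁻ 0
    head = *-congˡ (trans (reflexive (≡.cong (λ e → δ e d) (exponent-suc m 0))) (δ-suc (exponent m 0) d))

  laurent-expansion : ∀ m d → laurent m d ≈ Σk (suc m) (binomialTerm m d)
  laurent-expansion zero    d =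
    sym (trans (+-identityˡ _) (trans (*-congʳ (trans (*-identityʳ _) (+-identityʳ 1#))) (*-identityˡ _)))
  laurent-expansion (suc m) d = begin
    laurent m (ℤ.pred d) - laurent m (ℤ.suc d)
      ≈⟨ +-cong (laurent-expansion m (ℤ.pred d)) (-‿cong (laurent-expansion m (ℤ.suc d))) ⟩
    Σk (suc m) (binomialTerm m (ℤ.pred d)) - Σk (suc m) (binomialTerm m (ℤ.suc d))
      ≈⟨ sym (binomialSum-pascal m d) ⟩
    Σk (suc (suc m)) (binomialTerm (suc m) d) ∎

  D-· : ∀ X i j → (D · X) i j ≈ ⊕ X i j - ⊖ X i j
  D-· X i j = begin
    Σk (suc (suc i)) (λ k → (⊕ 𝓘 i k - 𝓘 (suc i) k) * X k j)
      ≈⟨ Σk-cong (suc (suc i)) (λ k _ → [y-z]x≈yx-zx (X k j) (⊕ 𝓘 i k) (𝓘 (suc i) k)) ⟩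
    Σk (suc (suc i)) (λ k → ⊕ 𝓘 i k * X k j - 𝓘 (suc i) k * X k j)
      ≈⟨ Σk-- (suc (suc i)) _ _ ⟩
    Σk (suc (suc i)) (λ k → ⊕ 𝓘 i k * X k j) - Σk (suc (suc i)) (λ k → 𝓘 (suc i) k * X k j)
      ≈⟨ +-cong (Σk-⊕𝓘 X i j (ℕₚ.<-trans (ℕₚ.n<1+n i) (ℕₚ.n<1+n (suc i))))
                (-‿cong (Σk-𝓘 (suc i) (λ k → X k j) (ℕₚ.n<1+n (suc i)))) ⟩
    ⊕ X i j - ⊖ X i j ∎

  imageSum : ℕ → Matrix
  imageSum m i j = laurent m (+ i ℤ.- + j) + sign j * laurent m (+ (suc i ℕ.+ suc j))

  imageSum-suc : ∀ m i j → imageSum (suc m) i j ≈ (⊕ (imageSum m) ⊟ ⊖ (imageSum m)) i j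
  imageSum-suc m zero j = begin
    (laurent m (ℤ.pred (+ 0 ℤ.- + j)) - laurent m (ℤ.suc (+ 0 ℤ.- + j))) + s * (H - Q)
      ≡⟨ ≡.cong₂ (λ x y → (laurent m x - laurent m y) + s * (H - Q)) pred[0-j] suc[0-j] ⟩
    (laurent m (ℤ.- + suc j) - P) + s * (H - Q)
      ≈⟨ +-cong (+-congʳ (laurent-neg m (+ suc j))) (x[y-z]≈xy-xz s H Q) ⟩
    (- s * H - P) + (s * H - s * Q)
      ≈⟨ [a-b]+[c-d]≈[a+c]-[b+d] _ _ _ _ ⟩
    (- s * H + s * H) - (P + s * Q)
      ≈⟨ +-congʳ (trans (+-congʳ (sym (-‿distribˡ-* s H))) (-‿inverseˡ (s * H))) ⟩
    0# - (P + s * Q) ∎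
    where
    s H P Q : Carrier
    s = sign j
    H = laurent m (+ suc j)
    P = laurent m (+ 1 ℤ.- + j)
    Q = laurent m (+ suc (suc (suc j)))
    pred[0-j] : ℤ.pred (+ 0 ℤ.- + j) ≡ ℤ.- + suc j
    pred[0-j] = ≡.trans (≡.cong ℤ.pred (ℤₚ.+-identityˡ (ℤ.- + j))) (≡.sym (ℤₚ.neg-suc j))
    suc[0-j] : ℤ.suc (+ 0 ℤ.- + j) ≡ + 1 ℤ.- + j
    suc[0-j] = ≡.sym (ℤₚ.suc-+ 0 (ℤ.- + j))
  imageSum-suc m (suc i) j = begin
    (laurent m (ℤ.pred a) - laurent m (ℤ.suc a)) + s * (laurent m G - laurent m G₂)
      ≡⟨ ≡.cong₂ (λ x y → (laurent m x - laurent m y) + s * (laurent m G - laurent m G₂))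
                 (≡.trans (≡.cong ℤ.pred (ℤₚ.suc-+ i (ℤ.- + j))) (ℤₚ.pred-suc _))
                 (≡.sym (ℤₚ.suc-+ (suc i) (ℤ.- + j))) ⟩
    (laurent m (+ i ℤ.- + j) - laurent m (+ suc (suc i) ℤ.- + j)) + s * (laurent m G - laurent m G₂)
      ≈⟨ +-congˡ (x[y-z]≈xy-xz s _ _) ⟩
    (laurent m (+ i ℤ.- + j) - laurent m (+ suc (suc i) ℤ.- + j)) + (s * laurent m G - s * laurent m G₂)
      ≈⟨ [a-b]+[c-d]≈[a+c]-[b+d] _ _ _ _ ⟩
    imageSum m i j - imageSum m (suc (suc i)) j ∎
    where
    s : Carrier
    s = sign j
    a G G₂ : ℤ
    a = + suc i ℤ.- + j
    G = + (suc i ℕ.+ suc j)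
    G₂ = + (suc (suc (suc i)) ℕ.+ suc j)

  ⊕-cong : ∀ {X Y} → X ≋ Y → ⊕ X ≋ ⊕ Y
  ⊕-cong X≋Y zero    j = refl
  ⊕-cong X≋Y (suc i) j = X≋Y i j

  pow-D : ∀ m → pow D m ≋ imageSum m
  pow-D zero i j = begin
    𝓘 i j                    ≡⟨⟩
    δ (+ i) (0ℤ ℤ.+ + j)     ≈⟨ δ-translate (+ i) 0ℤ (+ j) ⟩
    laurent 0 (+ i ℤ.- + j)  ≈⟨ sym (trans (+-congˡ (zeroʳ _)) (+-identityʳ _)) ⟩
    imageSum 0 i j           ∎
  pow-D (suc m) i j = begin
    (D · pow D m) i j                       ≈⟨ D-· (pow D m) i j ⟩
    ⊕ (pow D m) i j - ⊖ (pow D m) i j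
      ≈⟨ +-cong (⊕-cong (pow-D m) i j) (-‿cong (pow-D m (suc i) j)) ⟩
    ⊕ (imageSum m) i j - ⊖ (imageSum m) i j ≈⟨ sym (imageSum-suc m i j) ⟩
    imageSum (suc m) i j                    ∎

  iter-⊕-𝓘 : ∀ n i j → iter n ⊕ 𝓘 i j ≈ δ (+ i) (+ n ℤ.+ + j)
  iter-⊕-𝓘 zero    i       j = refl
  iter-⊕-𝓘 (suc n) zero    j = refl
  iter-⊕-𝓘 (suc n) (suc i) j = iter-⊕-𝓘 n i j

  iter-⊖-𝓘 : ∀ n i j → iter n ⊖ 𝓘 i j ≈ δ (+ i) (ℤ.- + n ℤ.+ + j)
  iter-⊖-𝓘 zero    i j = refl
  iter-⊖-𝓘 (suc n) i j = begin
    iter n ⊖ 𝓘 (suc i) j               ≈⟨ iter-⊖-𝓘 n (suc i) j ⟩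
    δ (ℤ.suc (+ i)) (ℤ.- + n ℤ.+ + j)  ≈⟨ δ-suc (+ i) (ℤ.- + n ℤ.+ + j) ⟩
    δ (+ i) (ℤ.pred (ℤ.- + n ℤ.+ + j)) ≡⟨ ≡.cong (δ (+ i)) pred[-n+j] ⟩
    δ (+ i) (-[1+ n ] ℤ.+ + j)         ∎
    where
    pred[-n+j] : ℤ.pred (ℤ.- + n ℤ.+ + j) ≡ -[1+ n ] ℤ.+ + j
    pred[-n+j] = ≡.sym (≡.trans (≡.cong (ℤ._+ + j) (ℤₚ.neg-suc n)) (ℤₚ.pred-+ (ℤ.- + n) (+ j)))

  ⊕^-𝓘 : ∀ z i j → ⊕^ z 𝓘 i j ≈ δ (+ i) (z ℤ.+ + j)
  ⊕^-𝓘 (+ n)    = iter-⊕-𝓘 n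
  ⊕^-𝓘 -[1+ n ] = iter-⊖-𝓘 (suc n)

  ΣM-⊕^ : ∀ m i j →
    ΣM (suc m) (λ r → coeff m r ⊛ ⊕^ (exponent m r) 𝓘) i j ≈ laurent m (+ i ℤ.- + j)
  ΣM-⊕^ m i j = begin
    ΣM (suc m) (λ r → coeff m r ⊛ ⊕^ (exponent m r) 𝓘) i j
      ≈⟨ ΣM-entry (suc m) _ i j ⟩
    Σk (suc m) (λ r → coeff m r * ⊕^ (exponent m r) 𝓘 i j)
      ≈⟨ Σk-cong (suc m) (λ r _ → *-congˡ (shifted-𝓘 r)) ⟩
    Σk (suc m) (binomialTerm m (+ i ℤ.- + j))
      ≈⟨ sym (laurent-expansion m _) ⟩
    laurent m (+ i ℤ.- + j) ∎
    where
    shifted-𝓘 : ∀ r → ⊕^ (exponent m r) 𝓘 i j ≈ δ (exponent m r) (+ i ℤ.- + j)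
    shifted-𝓘 r = trans (⊕^-𝓘 (exponent m r) i j) (δ-translate (+ i) (exponent m r) (+ j))

  𝓙-as-𝟙 : ∀ {m a} i j → a < m →
           𝓙 (m ∸ 1 ∸ a) i j ≈ sign i * 𝟙 (m ℕ.≟ a ℕ.+ (suc i ℕ.+ suc j))
  𝓙-as-𝟙 {suc m} {a} i j (s≤s a≤m) =
    trans (if-then-else-0 _ (sign i))
          (*-congˡ (𝟙-cong (G ℕ.≟ suc (m ∸ a)) (suc m ℕ.≟ a ℕ.+ G) to from))
    where
    G : ℕ
    G = suc i ℕ.+ suc j
    to : G ≡ suc (m ∸ a) → suc m ≡ a ℕ.+ G
    to e = ≡.trans (≡.cong suc (≡.sym (ℕₚ.m+[n∸m]≡n a≤m)))
                   (≡.trans (≡.sym (ℕₚ.+-suc a (m ∸ a))) (≡.cong (a ℕ.+_) (≡.sym e)))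
    from : suc m ≡ a ℕ.+ G → G ≡ suc (m ∸ a)
    from e = ≡.trans (≡.sym (ℕₚ.m+n∸m≡n a G))
                     (≡.trans (≡.cong (_∸ a) (≡.sym e)) (ℕₚ.+-∸-assoc 1 a≤m))

  𝓙-term : ∀ {m l} i j → l < m / 2 →
    sign m * (coeff m l * 𝓙 (m ∸ 1 ∸ 2 ℕ.* l) i j) ≈ sign j * binomialTerm m (+ (suc i ℕ.+ suc j)) l
  𝓙-term {m} {l} i j l<m/2 = begin
    sign m * (coeff m l * 𝓙 (m ∸ 1 ∸ 2 ℕ.* l) i j)
      ≈⟨ *-congˡ (*-congˡ (𝓙-as-𝟙 i j 2l<m)) ⟩
    sign m * (coeff m l * (sign i * 𝟙 image?))
      ≈⟨ trans (*-congˡ (sym (*-assoc _ _ _)))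
               (trans (sym (*-assoc _ _ _)) (*-congʳ (x∙yz≈xz∙y _ _ _))) ⟩
    sign m * sign i * coeff m l * 𝟙 image?
      ≈⟨ *𝟙-congʳ image? (λ { ≡.refl → *-congʳ (sign-image l i j) }) ⟩
    sign j * coeff m l * 𝟙 image?
      ≈⟨ trans (*-assoc _ _ _) (*-congˡ (*-congˡ (sym (δ-minus m (2 ℕ.* l) G)))) ⟩
    sign j * binomialTerm m (+ G) l ∎
    where
    G : ℕ
    G = suc i ℕ.+ suc j
    image? : Dec (m ≡ 2 ℕ.* l ℕ.+ G)
    image? = m ℕ.≟ 2 ℕ.* l ℕ.+ G
    2l<m : 2 ℕ.* l < m
    2l<m = ℕₚ.≤-trans (ℕₚ.n≤1+n _)
                      (ℕₚ.≤-trans (ℕₚ.≤-reflexive (≡.sym (ℕₚ.*-suc 2 l))) (≤/2⇒2*≤ l<m/2))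

  binomialTerm-beyond-half : ∀ {m k} i j → m / 2 ≤ k → binomialTerm m (+ (suc i ℕ.+ suc j)) k ≈ 0#
  binomialTerm-beyond-half {m} {k} i j m/2≤k = begin
    coeff m k * δ (exponent m k) (+ G) ≈⟨ *-congˡ (δ-minus m (2 ℕ.* k) G) ⟩
    coeff m k * 𝟙 image?               ≈⟨ *-congˡ (𝟙-no image? (ℕₚ.≤⇒≯ m/2≤k ∘ overshoot)) ⟩
    coeff m k * 0#                     ≈⟨ zeroʳ _ ⟩
    0#                                 ∎
    where
    G : ℕ
    G = suc i ℕ.+ suc j
    image? : Dec (m ≡ 2 ℕ.* k ℕ.+ G)
    image? = m ℕ.≟ 2 ℕ.* k ℕ.+ G
    2≤G : 2 ≤ G
    2≤G = s≤s (ℕₚ.≤-trans (s≤s z≤n) (ℕₚ.m≤n+m (suc j) i))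
    overshoot : m ≡ 2 ℕ.* k ℕ.+ G → k < m / 2
    overshoot ≡.refl =
      2*≤⇒≤/2 (ℕₚ.≤-trans (ℕₚ.≤-reflexive 2[1+k]≡2k+2) (ℕₚ.+-monoʳ-≤ (2 ℕ.* k) 2≤G))
      where
      2[1+k]≡2k+2 : 2 ℕ.* suc k ≡ 2 ℕ.* k ℕ.+ 2
      2[1+k]≡2k+2 = ≡.trans (ℕₚ.*-suc 2 k) (ℕₚ.+-comm 2 _)

  ΣM-𝓙 : ∀ m i j →
    sign m * ΣM (m / 2) (λ l → coeff m l ⊛ 𝓙 (m ∸ 1 ∸ 2 ℕ.* l)) i j ≈
    sign j * laurent m (+ (suc i ℕ.+ suc j))
  ΣM-𝓙 m i j = begin
    sign m * ΣM (m / 2) (λ l → coeff m l ⊛ 𝓙 (m ∸ 1 ∸ 2 ℕ.* l)) i j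
      ≈⟨ trans (*-congˡ (ΣM-entry (m / 2) _ i j)) (sym (Σk-*ˡ (m / 2) (sign m) _)) ⟩
    Σk (m / 2) (λ l → sign m * (coeff m l * 𝓙 (m ∸ 1 ∸ 2 ℕ.* l) i j))
      ≈⟨ Σk-cong (m / 2) (λ l → 𝓙-term i j) ⟩
    Σk (m / 2) (λ l → sign j * binomialTerm m G l)
      ≈⟨ Σk-*ˡ (m / 2) (sign j) _ ⟩
    sign j * Σk (m / 2) (binomialTerm m G)
      ≈⟨ *-congˡ (sym (Σk-tail _ (ℕₚ.m≤n⇒m≤1+n (m/n≤m m 2))
                                 (λ k m/2≤k _ → binomialTerm-beyond-half i j m/2≤k))) ⟩
    sign j * Σk (suc m) (binomialTerm m G)
      ≈⟨ *-congˡ (sym (laurent-expansion m G)) ⟩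
    sign j * laurent m G ∎
    where
    G : ℤ
    G = + (suc i ℕ.+ suc j)

theorem3 : ∀ {c ℓ} (F : Field c ℓ) (m : ℕ) →
    let open Field F
        open FieldMatrices F
    in pow D m ≋
         ΣM (suc m) (λ r → (fromℕ (m C r) * sign r) ⊛ ⊕^ (+ m ℤ.- + (2 ℕ.* r)) 𝓘)
       ⊞ sign m ⊛ ΣM (m / 2) (λ l → (fromℕ (m C l) * sign l) ⊛ 𝓙 (m ∸ 1 ∸ 2 ℕ.* l))
theorem3 F m i j = trans (pow-D F m i j) (sym (+-cong (ΣM-⊕^ F m i j) (ΣM-𝓙 F m i j)))
  where open Field F
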